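{- For every short partizan game $X\in\mathcal{G}$ there is an even-tempered game $H\in I_{ -2}$ with $\psi(H)=X$. Moreover, if $X$ is not an integer, $H$ can be chosen so that the left options of $\psi(H)$ are equal to the left options of $X$ and the right options of $\psi(H)$ are equal to the right options of $X$.
   Context: Well-tempered $\mathbb{Z}$-valued games: an even-tempered game is an integer (a "number", with no options) or $\langle L\mid R\rangle$ with $L,R$ finite nonempty sets of odd-tempered games; an odd-tempered game is $\langle L\mid R\rangle$ with $L,R$ finite nonempty sets of even-tempered games. Outcomes: $L(n)=R(n)=n$ for numbers; otherwise $L(G)=\max_{G^L}R(G^L)$, $R(G)=\min_{G^R}L(G^R)$. For an integer $n$, $G\in I_n$ iff every option of $G$ is in $I_n$ and $L(G)\ge R(G)$ if $G$ is even-tempered, $L(G)-R(G)\ge n$ if $G$ is odd-tempered. $\mathcal{G}$ is the group of short partizan games in Conway's sense (a given $X$ is taken with a fixed form $\{X^L\mid X^R\}$). The map $\psi:I_{ -2}\to\mathcal{G}$ is defined by $\psi(n)=n$ for integers and $\psi(G)=\{\psi(G^L)\mid\psi(G^R)\}$ otherwise. -}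

module Defs where

open import Data.Bool using (Bool; true; false; not)
open import Data.Integer using (ℤ; +_; -[1+_]; _⊔_; _⊓_; _-_; _≤_)
open import Data.Nat using (ℕ; zero; suc)
open import Data.List using (List; []; _∷_; _++_)
open import Data.List.NonEmpty using (List⁺; _∷_; toList)
open import Data.List.Relation.Unary.All using (All)
open import Data.List.Relation.Unary.Any using (Any)
open import Data.Product using (_×_; Σ)
open import Relation.Nullary using (¬_)

data Game : Set where
  mk : List Game → List Game → Game

leftOpts : Game → List Game
leftOpts (mk l _) = l

rightOpts : Game → List Game
rightOpts (mk _ r) = r

-- Conway's order:  G ≤ H  iff no G^L with H ≤ G^L and no H^R with H^R ≤ G;
-- G ⧏ H (i.e. not H ≤ G) iff some H^L with G ≤ H^L or some G^R with G^R ≤ H.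
mutual
  data _≤G_ : Game → Game → Set where
    le : ∀ {G H} → All (λ gl → gl ⧏ H) (leftOpts G)
                 → All (λ hr → G ⧏ hr) (rightOpts H) → G ≤G H

  data _⧏_ : Game → Game → Set where
    lfL : ∀ {G H} → Any (λ hl → G ≤G hl) (leftOpts H) → G ⧏ H
    lfR : ∀ {G H} → Any (λ gr → gr ≤G H) (rightOpts G) → G ⧏ H

_≈G_ : Game → Game → Set
G ≈G H = (G ≤G H) × (H ≤G G)

fromℕ : ℕ → Game
fromℕ zero = mk [] []
fromℕ (suc n) = mk (fromℕ n ∷ []) []

fromNeg : ℕ → Game
fromNeg zero = mk [] []
fromNeg (suc n) = mk [] (fromNeg n ∷ [])

fromℤ : ℤ → Game
fromℤ (+ n) = fromℕ n
fromℤ -[1+ n ] = fromNeg (suc n)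

IsInteger : Game → Set
IsInteger X = Σ ℤ λ n → X ≈G fromℤ n

SameOptSet : List Game → List Game → Set
SameOptSet as bs = All (λ a → Any (λ b → a ≈G b) bs) as × All (λ b → Any (λ a → a ≈G b) as) bs

SameOptions : Game → Game → Set
SameOptions A B = SameOptSet (leftOpts A) (leftOpts B) × SameOptSet (rightOpts A) (rightOpts B)

-- Well-tempered ℤ-valued games.  WG true = even-tempered, WG false = odd-tempered.

data WG : Bool → Set where
  num : ℤ → WG true
  opt : ∀ {p} → List⁺ (WG (not p)) → List⁺ (WG (not p)) → WG p

mutual
  Lo : ∀ {p} → WG p → ℤ
  Lo (num n) = n
  Lo (opt (g ∷ gs) _) = maxRo g gs

  Ro : ∀ {p} → WG p → ℤ
  Ro (num n) = n
  Ro (opt _ (g ∷ gs)) = minLo g gs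

  maxRo : ∀ {p} → WG p → List (WG p) → ℤ
  maxRo g [] = Ro g
  maxRo g (h ∷ hs) = Ro g ⊔ maxRo h hs

  minLo : ∀ {p} → WG p → List (WG p) → ℤ
  minLo g [] = Lo g
  minLo g (h ∷ hs) = Lo g ⊓ minLo h hs

optionsW : ∀ {p} → WG p → List (WG (not p))
optionsW (num _) = []
optionsW (opt l r) = toList l ++ toList r

Cond : ℤ → ∀ {p} → WG p → Set
Cond n {true} G = Ro G ≤ Lo G
Cond n {false} G = n ≤ Lo G - Ro G

data InI (n : ℤ) : ∀ {p} → WG p → Set where
  mkI : ∀ {p} {G : WG p} → Cond n G → All (InI n) (optionsW G) → InI n G

mutual
  ψ : ∀ {p} → WG p → Game
  ψ (num n) = fromℤ n
  ψ (opt (l ∷ ls) (r ∷ rs)) = mk (ψ l ∷ ψs ls) (ψ r ∷ ψs rs)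

  ψs : ∀ {p} → List (WG p) → List Game
  ψs [] = []
  ψs (g ∷ gs) = ψ g ∷ ψs gs

-- The key notion is a pair of integer thresholds of a well-tempered game G:
-- upperT G (= L(G) if G is even-tempered, L(G)+1 if odd) and lowerT G
-- (= R(G), resp. R(G)-1).  In this normalisation the two parities behave alike:
--   * upperT G is one more than the largest lowerT of a left option of G,
--     lowerT G one less than the smallest upperT of a right option, and
--   * the local condition of I₋₂ at G says exactly  lowerT G ≤ upperT G.
-- The central lemma (thresholds) states that for G ∈ I₋₂ the value ψ(G) is
-- compared with the integers through these thresholds: ψ(G) ≤ k iff k ≥ upperT G,
-- and k ≤ ψ(G) iff k ≤ lowerT G.
-- Consequently a form {G^L | G^R} with options in I₋₂ is either itself in I₋₂, or
-- its thresholds leave a gap, and then ψ of it is an integer by the simplicity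
-- theorem for integers.  The theorem follows by recursion on X: a representative
-- is built from representatives of the options; when the form collapses to an
-- integer j one uses the number j (even) or ⟨j-1 | j+1⟩ (odd) instead.

module Submission where

open import Defs
open import Data.Bool using (true)
open import Data.Integer using (-[1+_])
open import Data.Product using (_×_; Σ)
open import Relation.Nullary using (¬_)

open import Data.Bool using (Bool; false; not)
open import Data.Integer as ℤ using (ℤ; +_; _-_; _≤_; _<_; _+_; 1ℤ; -1ℤ; -≤-; -≤+; +≤+; -<-; -<+; +<+)
open import Data.Integer.Properties as ℤP using (≤-refl; ≤-trans; ≤-<-trans; <-≤-trans; ≰⇒>; _≤?_)
open import Data.Integer.Tactic.RingSolver using (solve-∀)
open import Data.Nat as ℕ using (ℕ; zero; suc; z≤n; s≤s)
import Data.Nat.Properties as ℕP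
open import Data.List using (List; []; _∷_)
open import Data.List.NonEmpty using (List⁺; _∷_; toList)
open import Data.List.Relation.Unary.All as All using (All; []; _∷_)
open import Data.List.Relation.Unary.Any as Any using (Any; here; there)
import Data.List.Relation.Unary.All.Properties as AllP
open import Data.List.Relation.Binary.Pointwise as Pointwise using (Pointwise; []; _∷_)
open import Data.Product using (_,_; proj₁; proj₂)
open import Data.Sum using (_⊎_; inj₁; inj₂; [_,_]′)
open import Data.Empty using (⊥-elim)
open import Relation.Nullary using (yes; no)
open import Relation.Binary.PropositionalEquality using (_≡_; sym; trans; subst)

mutual
  ≤G-trans : ∀ {A B C} → A ≤G B → B ≤G C → A ≤G C
  ≤G-trans A≤B@(le AL⧏B _) B≤C@(le _ B⧏CR) = le (all-⧏≤-trans AL⧏B B≤C) (all-≤⧏-trans A≤B B⧏CR)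

  all-⧏≤-trans : ∀ {B C xs} → All (_⧏ B) xs → B ≤G C → All (_⧏ C) xs
  all-⧏≤-trans [] _ = []
  all-⧏≤-trans (p ∷ ps) B≤C = ⧏≤-trans p B≤C ∷ all-⧏≤-trans ps B≤C

  all-≤⧏-trans : ∀ {A B ys} → A ≤G B → All (B ⧏_) ys → All (A ⧏_) ys
  all-≤⧏-trans _ [] = []
  all-≤⧏-trans A≤B (q ∷ qs) = ≤⧏-trans A≤B q ∷ all-≤⧏-trans A≤B qs

  ⧏≤-trans : ∀ {A B C} → A ⧏ B → B ≤G C → A ⧏ C
  ⧏≤-trans (lfL A≤BL) (le BL⧏C _) = viaLeftOption A≤BL BL⧏C
  ⧏≤-trans (lfR AR≤B) B≤C = lfR (any-≤G-trans AR≤B B≤C)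

  ≤⧏-trans : ∀ {A B C} → A ≤G B → B ⧏ C → A ⧏ C
  ≤⧏-trans A≤B (lfL B≤CL) = lfL (≤G-trans-any A≤B B≤CL)
  ≤⧏-trans (le _ A⧏BR) (lfR BR≤C) = viaRightOption A⧏BR BR≤C

  viaLeftOption : ∀ {A C xs} → Any (A ≤G_) xs → All (_⧏ C) xs → A ⧏ C
  viaLeftOption (here A≤x) (x⧏C ∷ _) = ≤⧏-trans A≤x x⧏C
  viaLeftOption (there a) (_ ∷ ps) = viaLeftOption a ps

  viaRightOption : ∀ {A C xs} → All (A ⧏_) xs → Any (_≤G C) xs → A ⧏ C
  viaRightOption (A⧏x ∷ _) (here x≤C) = ⧏≤-trans A⧏x x≤C
  viaRightOption (_ ∷ ps) (there a) = viaRightOption ps a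

  any-≤G-trans : ∀ {B C xs} → Any (_≤G B) xs → B ≤G C → Any (_≤G C) xs
  any-≤G-trans (here x≤B) B≤C = here (≤G-trans x≤B B≤C)
  any-≤G-trans (there a) B≤C = there (any-≤G-trans a B≤C)

  ≤G-trans-any : ∀ {A B xs} → A ≤G B → Any (B ≤G_) xs → Any (A ≤G_) xs
  ≤G-trans-any A≤B (here B≤x) = here (≤G-trans A≤B B≤x)
  ≤G-trans-any A≤B (there a) = there (≤G-trans-any A≤B a)

mutual
  ≤G-or-⧏ : ∀ A B → (A ≤G B) ⊎ (B ⧏ A)
  ≤G-or-⧏ (mk AL AR) (mk BL BR) with leftOptionsBelow (mk BL BR) AL | rightOptionsAbove (mk AL AR) BR
  ... | inj₁ AL⧏B | inj₁ A⧏BR = inj₁ (le AL⧏B A⧏BR)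
  ... | inj₂ B≤AL | _ = inj₂ (lfL B≤AL)
  ... | inj₁ _ | inj₂ BR≤A = inj₂ (lfR BR≤A)

  leftOptionsBelow : ∀ B xs → All (_⧏ B) xs ⊎ Any (B ≤G_) xs
  leftOptionsBelow B [] = inj₁ []
  leftOptionsBelow B (x ∷ xs) with ≤G-or-⧏ B x
  ... | inj₁ B≤x = inj₂ (here B≤x)
  ... | inj₂ x⧏B with leftOptionsBelow B xs
  ...   | inj₁ xs⧏B = inj₁ (x⧏B ∷ xs⧏B)
  ...   | inj₂ B≤xs = inj₂ (there B≤xs)

  rightOptionsAbove : ∀ A ys → All (A ⧏_) ys ⊎ Any (_≤G A) ys
  rightOptionsAbove A [] = inj₁ []
  rightOptionsAbove A (y ∷ ys) with ≤G-or-⧏ y A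
  ... | inj₁ y≤A = inj₂ (here y≤A)
  ... | inj₂ A⧏y with rightOptionsAbove A ys
  ...   | inj₁ A⧏ys = inj₁ (A⧏y ∷ A⧏ys)
  ...   | inj₂ ys≤A = inj₂ (there ys≤A)

≈G-sym : ∀ {A B} → A ≈G B → B ≈G A
≈G-sym (A≤B , B≤A) = B≤A , A≤B

≈G-trans : ∀ {A B C} → A ≈G B → B ≈G C → A ≈G C
≈G-trans (A≤B , B≤A) (B≤C , C≤B) = ≤G-trans A≤B B≤C , ≤G-trans C≤B B≤A

pointwise-covered : ∀ {as bs} → Pointwise _≈G_ as bs → All (λ a → Any (a ≈G_) bs) as
pointwise-covered [] = []
pointwise-covered (e ∷ es) = here e ∷ All.map there (pointwise-covered es)

pointwise-covers : ∀ {as bs} → Pointwise _≈G_ as bs → All (λ b → Any (_≈G b) as) bs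
pointwise-covers [] = []
pointwise-covers (e ∷ es) = here e ∷ All.map there (pointwise-covers es)

pointwise-sameOptSet : ∀ {as bs} → Pointwise _≈G_ as bs → SameOptSet as bs
pointwise-sameOptSet es = pointwise-covered es , pointwise-covers es

form-≤G : ∀ {L L' R R'} → Pointwise _≈G_ L L' → Pointwise _≈G_ R R' → mk L R ≤G mk L' R'
form-≤G eL eR = le (All.map (λ a → lfL (Any.map proj₁ a)) (pointwise-covered eL))
                   (All.map (λ a → lfR (Any.map proj₁ a)) (pointwise-covers eR))

form-≈G : ∀ {L L' R R'} → Pointwise _≈G_ L L' → Pointwise _≈G_ R R' → mk L R ≈G mk L' R'
form-≈G eL eR = form-≤G eL eR , form-≤G (Pointwise.symmetric ≈G-sym eL) (Pointwise.symmetric ≈G-sym eR)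

fromℕ-mono : ∀ {m n} → m ℕ.≤ n → fromℕ m ≤G fromℕ n
fromℕ-mono {zero} {zero} z≤n = le [] []
fromℕ-mono {zero} {suc n} z≤n = le [] []
fromℕ-mono (s≤s m≤n) = le (lfL (here (fromℕ-mono m≤n)) ∷ []) []

fromNeg-antitone : ∀ {m n} → n ℕ.≤ m → fromNeg m ≤G fromNeg n
fromNeg-antitone {zero} {zero} z≤n = le [] []
fromNeg-antitone {suc m} {zero} z≤n = le [] []
fromNeg-antitone (s≤s n≤m) = le [] (lfR (here (fromNeg-antitone n≤m)) ∷ [])

fromNeg≤fromℕ : ∀ m n → fromNeg m ≤G fromℕ n
fromNeg≤fromℕ zero zero = le [] []
fromNeg≤fromℕ zero (suc n) = le [] []
fromNeg≤fromℕ (suc m) zero = le [] []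
fromNeg≤fromℕ (suc m) (suc n) = le [] []

fromℤ-mono : ∀ {i j} → i ≤ j → fromℤ i ≤G fromℤ j
fromℤ-mono (-≤- n≤m) = fromNeg-antitone (s≤s n≤m)
fromℤ-mono (-≤+ {m} {n}) = fromNeg≤fromℕ (suc m) n
fromℤ-mono (+≤+ m≤n) = fromℕ-mono m≤n

fromℤ-strict : ∀ {i j} → i < j → fromℤ i ⧏ fromℤ j
fromℤ-strict (+<+ (s≤s m≤n)) = lfL (here (fromℕ-mono m≤n))
fromℤ-strict (-<+ {m} {n}) = lfR (here (fromNeg≤fromℕ m n))
fromℤ-strict (-<- {suc m} n≤m) = lfR (here (fromNeg-antitone n≤m))

≤integer : ∀ G k → All (_⧏ fromℤ k) (leftOpts G) → (∀ i → k < i → G ⧏ fromℤ i) → G ≤G fromℤ k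
≤integer G (+ zero) GL⧏k _ = le GL⧏k []
≤integer G (+ suc n) GL⧏k _ = le GL⧏k []
≤integer G -[1+ zero ] GL⧏k G⧏above = le GL⧏k (G⧏above (+ 0) -<+ ∷ [])
≤integer G -[1+ suc n ] GL⧏k G⧏above = le GL⧏k (G⧏above -[1+ n ] (-<- ℕP.≤-refl) ∷ [])

integer≤ : ∀ G k → All (fromℤ k ⧏_) (rightOpts G) → (∀ i → i < k → fromℤ i ⧏ G) → fromℤ k ≤G G
integer≤ G -[1+ n ] k⧏GR _ = le [] k⧏GR
integer≤ G (+ zero) k⧏GR _ = le [] k⧏GR
integer≤ G (+ suc n) k⧏GR below⧏G = le (below⧏G (+ n) (+<+ ℕP.≤-refl) ∷ []) k⧏GR

-- Simplicity theorem for integers: if some integer k satisfies XL ⧏ k ⧏ XR for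
-- all options, then {XL | XR} is an integer: move k towards 0 while it stays strictly
-- between the options; the last such k is the value.
integerBetweenℕ : ∀ n XL XR → All (_⧏ fromℕ n) XL → All (fromℕ n ⧏_) XR → IsInteger (mk XL XR)
integerBetweenℕ zero XL XR XL⧏k k⧏XR = + 0 , le XL⧏k [] , le [] k⧏XR
integerBetweenℕ (suc n) XL XR XL⧏k k⧏XR with leftOptionsBelow (fromℕ n) XL
... | inj₁ XL⧏closer = integerBetweenℕ n XL XR XL⧏closer (All.map (≤⧏-trans (fromℕ-mono (ℕP.n≤1+n n))) k⧏XR)
... | inj₂ closer≤XL = + suc n , le XL⧏k [] , le (lfL closer≤XL ∷ []) k⧏XR

integerBetweenNeg : ∀ n XL XR → All (_⧏ fromNeg n) XL → All (fromNeg n ⧏_) XR → IsInteger (mk XL XR)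
integerBetweenNeg zero XL XR XL⧏k k⧏XR = + 0 , le XL⧏k [] , le [] k⧏XR
integerBetweenNeg (suc n) XL XR XL⧏k k⧏XR with rightOptionsAbove (fromNeg n) XR
... | inj₁ closer⧏XR = integerBetweenNeg n XL XR (All.map (λ p → ⧏≤-trans p (fromNeg-antitone (ℕP.n≤1+n n))) XL⧏k) closer⧏XR
... | inj₂ XR≤closer = -[1+ n ] , le XL⧏k (lfR XR≤closer ∷ []) , le [] k⧏XR

integerBetween : ∀ k XL XR → All (_⧏ fromℤ k) XL → All (fromℤ k ⧏_) XR → IsInteger (mk XL XR)
integerBetween (+ n) = integerBetweenℕ n
integerBetween -[1+ n ] = integerBetweenNeg (suc n)

IsInteger-≈G : ∀ {X Y} → X ≈G Y → IsInteger X → IsInteger Y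
IsInteger-≈G X≈Y (j , X≈j) = j , ≈G-trans (≈G-sym X≈Y) X≈j

fromNeg≤ : ∀ n {G} → All (fromNeg n ⧏_) (rightOpts G) → fromNeg n ≤G G
fromNeg≤ zero n⧏GR = le [] n⧏GR
fromNeg≤ (suc n) n⧏GR = le [] n⧏GR

≤fromℕ : ∀ n {G} → All (_⧏ fromℕ n) (leftOpts G) → G ≤G fromℕ n
≤fromℕ zero GL⧏n = le GL⧏n []
≤fromℕ (suc n) GL⧏n = le GL⧏n []

strictLowerBound : ∀ R → Σ ℕ λ n → All (fromNeg n ⧏_) R
strictLowerBound [] = 0 , []
strictLowerBound (mk _ R' ∷ rs) with strictLowerBound R' | strictLowerBound rs
... | a , a⧏R' | b , b⧏rs = suc a ℕ.⊔ b ,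
      ≤⧏-trans (fromNeg-antitone (ℕP.m≤m⊔n (suc a) b)) (lfR (here (fromNeg≤ a a⧏R'))) ∷
      All.map (≤⧏-trans (fromNeg-antitone (ℕP.m≤n⊔m (suc a) b))) b⧏rs

strictUpperBound : ∀ L → Σ ℕ λ n → All (_⧏ fromℕ n) L
strictUpperBound [] = 0 , []
strictUpperBound (mk L' _ ∷ ls) with strictUpperBound L' | strictUpperBound ls
... | a , L'⧏a | b , ls⧏b = suc a ℕ.⊔ b ,
      ⧏≤-trans (lfL (here (≤fromℕ a L'⧏a))) (fromℕ-mono (ℕP.m≤m⊔n (suc a) b)) ∷
      All.map (λ p → ⧏≤-trans p (fromℕ-mono (ℕP.m≤n⊔m (suc a) b))) ls⧏b

noLeftOptions⇒integer : ∀ R → IsInteger (mk [] R)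
noLeftOptions⇒integer R = let (n , n⧏R) = strictLowerBound R in integerBetweenNeg n [] R [] n⧏R

noRightOptions⇒integer : ∀ L → IsInteger (mk L [])
noRightOptions⇒integer L = let (n , L⧏n) = strictUpperBound L in integerBetweenℕ n L [] L⧏n []

maxRo-attained : ∀ {p} (P : ℤ → Set) (g : WG p) gs → P (maxRo g gs) → Any (λ o → P (Ro o)) (g ∷ gs)
maxRo-attained P g [] Pm = here Pm
maxRo-attained P g (h ∷ hs) Pm with ℤP.⊔-sel (Ro g) (maxRo h hs)
... | inj₁ m≡g = here (subst P m≡g Pm)
... | inj₂ m≡hs = there (maxRo-attained P h hs (subst P m≡hs Pm))

minLo-attained : ∀ {p} (P : ℤ → Set) (g : WG p) gs → P (minLo g gs) → Any (λ o → P (Lo o)) (g ∷ gs)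
minLo-attained P g [] Pm = here Pm
minLo-attained P g (h ∷ hs) Pm with ℤP.⊓-sel (Lo g) (minLo h hs)
... | inj₁ m≡g = here (subst P m≡g Pm)
... | inj₂ m≡hs = there (minLo-attained P h hs (subst P m≡hs Pm))

maxRo-bound : ∀ {p} (g : WG p) gs → All (λ o → Ro o ≤ maxRo g gs) (g ∷ gs)
maxRo-bound g [] = ≤-refl ∷ []
maxRo-bound g (h ∷ hs) = ℤP.i≤i⊔j (Ro g) (maxRo h hs)
                       ∷ All.map (λ q → ≤-trans q (ℤP.i≤j⊔i (Ro g) (maxRo h hs))) (maxRo-bound h hs)

minLo-bound : ∀ {p} (g : WG p) gs → All (λ o → minLo g gs ≤ Lo o) (g ∷ gs)
minLo-bound g [] = ≤-refl ∷ []
minLo-bound g (h ∷ hs) = ℤP.i⊓j≤i (Lo g) (minLo h hs)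
                       ∷ All.map (λ q → ≤-trans (ℤP.i⊓j≤j (Lo g) (minLo h hs)) q) (minLo-bound h hs)

upperT : ∀ {p} → WG p → ℤ
upperT {true} G = Lo G
upperT {false} G = ℤ.suc (Lo G)

lowerT : ∀ {p} → WG p → ℤ
lowerT {true} G = Ro G
lowerT {false} G = ℤ.pred (Ro G)

≤⇒<suc : ∀ {i j} → i ≤ j → i < ℤ.suc j
≤⇒<suc i≤j = ≤-<-trans i≤j (ℤP.suc[i]≤j⇒i<j ≤-refl)

<suc⇒≤ : ∀ {i j} → i < ℤ.suc j → i ≤ j
<suc⇒≤ {i} {j} i<j+1 = subst (i ≤_) (ℤP.pred-suc j) (ℤP.i<j⇒i≤pred[j] i<j+1)

≤⇒pred< : ∀ {i j} → i ≤ j → ℤ.pred i < j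
≤⇒pred< i≤j = <-≤-trans (ℤP.i≤pred[j]⇒i<j ≤-refl) i≤j

pred<⇒≤ : ∀ {i j} → ℤ.pred i < j → i ≤ j
pred<⇒≤ {i} {j} i-1<j = subst (_≤ j) (ℤP.suc-pred i) (ℤP.i<j⇒suc[i]≤j i-1<j)

upperT-witness : ∀ {p} (l r : List⁺ (WG (not p))) k → k < upperT (opt l r) → Any (λ o → k ≤ lowerT o) (toList l)
upperT-witness {true} (g ∷ gs) r k k<m = Any.map ℤP.i<j⇒i≤pred[j] (maxRo-attained (k <_) g gs k<m)
upperT-witness {false} (g ∷ gs) r k k<m+1 = maxRo-attained (k ≤_) g gs (<suc⇒≤ k<m+1)

upperT-bound : ∀ {p} (l r : List⁺ (WG (not p))) → All (λ o → lowerT o < upperT (opt l r)) (toList l)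
upperT-bound {true} (g ∷ gs) r = All.map ≤⇒pred< (maxRo-bound g gs)
upperT-bound {false} (g ∷ gs) r = All.map ≤⇒<suc (maxRo-bound g gs)

lowerT-witness : ∀ {p} (l r : List⁺ (WG (not p))) k → lowerT (opt l r) < k → Any (λ o → upperT o ≤ k) (toList r)
lowerT-witness {true} l (g ∷ gs) k m<k = Any.map ℤP.i<j⇒suc[i]≤j (minLo-attained (_< k) g gs m<k)
lowerT-witness {false} l (g ∷ gs) k m-1<k = minLo-attained (_≤ k) g gs (pred<⇒≤ m-1<k)

lowerT-bound : ∀ {p} (l r : List⁺ (WG (not p))) → All (λ o → lowerT (opt l r) < upperT o) (toList r)
lowerT-bound {true} l (g ∷ gs) = All.map ≤⇒<suc (minLo-bound g gs)
lowerT-bound {false} l (g ∷ gs) = All.map ≤⇒pred< (minLo-bound g gs)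

-- The local condition of I₋₂ says exactly that the thresholds do not cross.
-- For odd-tempered G it reads  -2 ≤ L - R,  i.e.  R - 1 ≤ L + 1.
shift-by-two : ∀ a b → (a - b) + + 2 ≡ (1ℤ + a) - (-1ℤ + b)
shift-by-two = solve-∀

unshift-by-two : ∀ d → (d + + 2) + -[1+ 1 ] ≡ d
unshift-by-two = solve-∀

condition⇒thresholds : ∀ {p} (G : WG p) → Cond -[1+ 1 ] G → lowerT G ≤ upperT G
condition⇒thresholds {true} G R≤L = R≤L
condition⇒thresholds {false} G -2≤L-R =
  ℤP.0≤i-j⇒j≤i (subst (+ 0 ≤_) (shift-by-two (Lo G) (Ro G)) (ℤP.+-monoˡ-≤ (+ 2) -2≤L-R))

thresholds⇒condition : ∀ {p} (G : WG p) → lowerT G ≤ upperT G → Cond -[1+ 1 ] G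
thresholds⇒condition {true} G R≤L = R≤L
thresholds⇒condition {false} G R-1≤L+1 =
  subst (-[1+ 1 ] ≤_) (unshift-by-two (Lo G - Ro G))
        (ℤP.+-monoˡ-≤ -[1+ 1 ] (subst (+ 0 ≤_) (sym (shift-by-two (Lo G) (Ro G))) (ℤP.i≤j⇒0≤j-i R-1≤L+1)))

record Thresholds {p} (G : WG p) : Set where
  field
    belowUpper : ∀ k → k < upperT G → fromℤ k ⧏ ψ G
    fromUpper  : ∀ k → upperT G ≤ k → ψ G ≤G fromℤ k
    aboveLower : ∀ k → lowerT G < k → ψ G ⧏ fromℤ k
    fromLower  : ∀ k → k ≤ lowerT G → fromℤ k ≤G ψ G
open Thresholds

any-ψ : ∀ {p} {P : WG p → Set} {Q : Game → Set} → (∀ {o} → P o → Q (ψ o)) → ∀ {gs} → Any P gs → Any Q (ψs gs)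
any-ψ f (here Po) = here (f Po)
any-ψ f (there a) = there (any-ψ f a)

all-ψ : ∀ {p} {P : WG p → Set} {Q : Game → Set} → (∀ {o} → P o → Q (ψ o)) → ∀ {gs} → All P gs → All Q (ψs gs)
all-ψ f [] = []
all-ψ f (Po ∷ Ps) = f Po ∷ all-ψ f Ps

any-with-all : ∀ {A : Set} {P Q : A → Set} {xs} → Any P xs → All Q xs → Any (λ x → P x × Q x) xs
any-with-all (here Px) (Qx ∷ _) = here (Px , Qx)
any-with-all (there a) (_ ∷ Qs) = there (any-with-all a Qs)

numberThresholds : ∀ j → Thresholds (num j)
numberThresholds j = record
  { belowUpper = λ k → fromℤ-strict
  ; fromUpper  = λ k → fromℤ-mono
  ; aboveLower = λ k → fromℤ-strict
  ; fromLower  = λ k → fromℤ-mono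
  }

-- A left option with lowerT ≥ k witnesses k ⧏ ψ(G); all left options lie ⧏ k once
-- k ≥ upperT G; the remaining comparisons with k ± 1 use the condition.
formThresholds : ∀ {p} (l r : List⁺ (WG (not p))) → lowerT (opt l r) ≤ upperT (opt l r)
               → All Thresholds (toList l) → All Thresholds (toList r) → Thresholds (opt l r)
formThresholds l r lower≤upper tl tr = record
  { belowUpper = below
  ; fromUpper  = λ k upper≤k → ≤integer (ψ G) k
      (all-ψ (λ (lo<up , t) → aboveLower t k (<-≤-trans lo<up upper≤k)) (All.zip (upperT-bound l r , tl)))
      (λ i k<i → above i (≤-<-trans lower≤upper (≤-<-trans upper≤k k<i)))
  ; aboveLower = above
  ; fromLower  = λ k k≤lower → integer≤ (ψ G) k
      (all-ψ (λ (lo<up , t) → belowUpper t k (≤-<-trans k≤lower lo<up)) (All.zip (lowerT-bound l r , tr)))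
      (λ i i<k → below i (<-≤-trans i<k (≤-trans k≤lower lower≤upper)))
  }
  where
  G = opt l r

  below : ∀ k → k < upperT G → fromℤ k ⧏ ψ G
  below k k<upper = lfL (any-ψ (λ (k≤lo , t) → fromLower t k k≤lo)
                              (any-with-all (upperT-witness l r k k<upper) tl))

  above : ∀ k → lowerT G < k → ψ G ⧏ fromℤ k
  above k lower<k = lfR (any-ψ (λ (up≤k , t) → fromUpper t k up≤k)
                              (any-with-all (lowerT-witness l r k lower<k) tr))

mutual
  thresholds : ∀ {p} {G : WG p} → InI -[1+ 1 ] G → Thresholds G
  thresholds {G = num j} _ = numberThresholds j
  thresholds {G = opt l r} (mkI cond optionsInI) =
    let (tl , tr) = AllP.++⁻ (toList l) (thresholdsAll optionsInI)
    in formThresholds l r (condition⇒thresholds (opt l r) cond) tl tr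

  thresholdsAll : ∀ {p} {gs : List (WG p)} → All (InI -[1+ 1 ]) gs → All Thresholds gs
  thresholdsAll [] = []
  thresholdsAll (g ∷ gs) = thresholds g ∷ thresholdsAll gs

-- If the thresholds of a form with options in I₋₂ cross, then k = upperT lies
-- strictly between all its left and right options, so ψ of the form is an integer.
crossedThresholds⇒integer : ∀ {p} (l r : List⁺ (WG (not p))) → All Thresholds (toList l) → All Thresholds (toList r)
                          → upperT (opt l r) < lowerT (opt l r) → IsInteger (ψ (opt l r))
crossedThresholds⇒integer l r tl tr upper<lower = integerBetween (upperT (opt l r)) _ _
  (all-ψ (λ (lo<up , t) → aboveLower t _ lo<up) (All.zip (upperT-bound l r , tl)))
  (all-ψ (λ (lo<up , t) → belowUpper t _ (ℤP.<-trans upper<lower lo<up)) (All.zip (lowerT-bound l r , tr)))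

formOrInteger : ∀ {p} (l r : List⁺ (WG (not p))) → All (InI -[1+ 1 ]) (toList l) → All (InI -[1+ 1 ]) (toList r)
              → InI -[1+ 1 ] (opt l r) ⊎ IsInteger (ψ (opt l r))
formOrInteger l r il ir with lowerT (opt l r) ≤? upperT (opt l r)
... | yes lower≤upper = inj₁ (mkI (thresholds⇒condition (opt l r) lower≤upper) (AllP.++⁺ il ir))
... | no lower≰upper = inj₂ (crossedThresholds⇒integer l r (thresholdsAll il) (thresholdsAll ir) (≰⇒> lower≰upper))

thresholdsMeet : ∀ {p} {G : WG p} j → InI -[1+ 1 ] G → upperT G ≤ j → j ≤ lowerT G → ψ G ≈G fromℤ j
thresholdsMeet j inI upper≤j j≤lower = fromUpper (thresholds inI) j upper≤j , fromLower (thresholds inI) j j≤lower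

Rep : Bool → Game → Set
Rep p X = Σ (WG p) λ H → InI -[1+ 1 ] H × ψ H ≈G X

FaithfulRep : Bool → Game → Set
FaithfulRep p X = Σ (WG p) λ H → InI -[1+ 1 ] H × ψ H ≈G X × SameOptions (ψ H) X

forgetOptions : ∀ {p X} → FaithfulRep p X → Rep p X
forgetOptions (H , inI , ψH≈X , _) = H , inI , ψH≈X

-- Integers have representatives of both parities: j itself, and ⟨j-1 | j+1⟩,
-- whose thresholds are both j.
integerRep : ∀ p {X} → IsInteger X → Rep p X
integerRep true (j , X≈j) = num j , mkI ≤-refl [] , ≈G-sym X≈j
integerRep false (j , X≈j) = H , inI , ≈G-trans (thresholdsMeet j inI upper≤j j≤lower) (≈G-sym X≈j)
  where
  H : WG false
  H = opt (num (ℤ.pred j) ∷ []) (num (ℤ.suc j) ∷ [])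

  upper≤j : upperT H ≤ j
  upper≤j = ℤP.≤-reflexive (ℤP.suc-pred j)

  j≤lower : j ≤ lowerT H
  j≤lower = ℤP.≤-reflexive (sym (ℤP.pred-suc j))

  inI : InI -[1+ 1 ] H
  inI = mkI (thresholds⇒condition H (ℤP.≤-reflexive (trans (ℤP.pred-suc j) (sym (ℤP.suc-pred j)))))
            (mkI ≤-refl [] ∷ mkI ≤-refl [] ∷ [])

games : ∀ {p xs} → All (Rep p) xs → List (WG p)
games = All.reduce proj₁

games-InI : ∀ {p xs} (rs : All (Rep p) xs) → All (InI -[1+ 1 ]) (games rs)
games-InI [] = []
games-InI ((_ , inI , _) ∷ rs) = inI ∷ games-InI rs

games-ψ : ∀ {p xs} (rs : All (Rep p) xs) → Pointwise _≈G_ (ψs (games rs)) xs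
games-ψ [] = []
games-ψ ((_ , _ , ψH≈x) ∷ rs) = ψH≈x ∷ games-ψ rs

formFromReps : ∀ {p x xs y ys} → All (Rep (not p)) (x ∷ xs) → All (Rep (not p)) (y ∷ ys)
             → IsInteger (mk (x ∷ xs) (y ∷ ys)) ⊎ FaithfulRep p (mk (x ∷ xs) (y ∷ ys))
formFromReps {p} rl@(rx ∷ rxs) rr@(ry ∷ rys) =
  [ (λ inI → inj₂ (opt l r , inI , form-≈G eL eR , pointwise-sameOptSet eL , pointwise-sameOptSet eR))
  , (λ integer → inj₁ (IsInteger-≈G (form-≈G eL eR) integer))
  ]′ (formOrInteger {p} l r (games-InI rl) (games-InI rr))
  where
  l = proj₁ rx ∷ games rxs
  r = proj₁ ry ∷ games rys
  eL = games-ψ rl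
  eR = games-ψ rr

mutual
  repOrInteger : ∀ p X → IsInteger X ⊎ FaithfulRep p X
  repOrInteger p (mk [] R) = inj₁ (noLeftOptions⇒integer R)
  repOrInteger p (mk (x ∷ xs) []) = inj₁ (noRightOptions⇒integer (x ∷ xs))
  repOrInteger p (mk (x ∷ xs) (y ∷ ys)) = formFromReps {p} (reps (not p) (x ∷ xs)) (reps (not p) (y ∷ ys))

  rep : ∀ p X → Rep p X
  rep p X = [ integerRep p , forgetOptions ]′ (repOrInteger p X)

  reps : ∀ p xs → All (Rep p) xs
  reps p [] = []
  reps p (x ∷ xs) = rep p x ∷ reps p xs

mainTheorem16 : ((X : Game) → Σ (WG true) λ H → InI -[1+ 1 ] H × ψ H ≈G X)
                × ((X : Game) → ¬ IsInteger X →
                     Σ (WG true) λ H → InI -[1+ 1 ] H × ψ H ≈G X × SameOptions (ψ H) X)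
mainTheorem16 = rep true , faithful
  where
  faithful : (X : Game) → ¬ IsInteger X → FaithfulRep true X
  faithful X notInteger = [ (λ integer → ⊥-elim (notInteger integer)) , (λ r → r) ]′ (repOrInteger true X)
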